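{- Let $G$ be a graph, $X\subseteq V(G)$ a vertex cover of $G$, and $k$ an integer. If the non-edge connection graph $H_{G,X}$ contains a set $T\subseteq V(G)\setminus X$ such that $S:=N_{H_{G,X}}(T)$ can be saturated by $2$-stars into $T$, then $T$ is a treewidth-invariant set in $G$.
   Context: The non-edge connection graph $H_{G,X}$ is the bipartite graph with partite sets $V(G)\setminus X$ and $\binom{X}{2}\setminus E(G)$ (one vertex $x_{\{p,q\}}$ for each pair of nonadjacent vertices $p,q\in X$), where $v\in V(G)\setminus X$ is adjacent to $x_{\{p,q\}}$ iff $v\in N_G(p)\cap N_G(q)$. For disjoint vertex sets $S,T$ of a graph $H$, $S$ is saturated by $q$-stars into $T$ if one can assign to each $v\in S$ a set $f(v)\subseteq N_H(v)\cap T$ of size $q$ such that $f(u)\cap f(v)=\emptyset$ for distinct $u,v\in S$ (the empty set is trivially saturated). Eliminating a vertex $v$ means removing $v$ and adding all missing edges between its neighbors. For an independent set $T$ of $G$, $\hat G_T$ is the graph obtained from $G$ by eliminating all vertices of $T$. An independent set $T$ is treewidth-invariant if for every $v\in T$, $\hat G_T$ is a minor of $G-\{v\}$. -}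

module Defs where

open import Data.Nat using (ℕ)
open import Data.Fin using (Fin; _<_)
open import Data.Fin.Subset using (Subset; _∈_; _∉_)
open import Data.Vec using (Vec; lookup)
open import Data.List using (List; []; _∷_)
open import Data.Product using (Σ; ∃; ∃-syntax; _×_; _,_)
open import Data.Sum using (_⊎_)
open import Relation.Nullary using (¬_; Dec)
open import Relation.Binary.PropositionalEquality using (_≡_; _≢_)

record Graph (n : ℕ) : Set₁ where
  field
    E     : Fin n → Fin n → Set
    sym   : ∀ {u v} → E u v → E v u
    irr   : ∀ {u} → ¬ E u u
    E?    : ∀ u v → Dec (E u v)
open Graph public

module _ {n : ℕ} (G : Graph n) where

  VertexCover : Subset n → Set
  VertexCover X = ∀ u v → E G u v → u ∈ X ⊎ v ∈ X

  Independent : Subset n → Set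
  Independent T = ∀ u v → u ∈ T → v ∈ T → ¬ E G u v

  -- Partite set 1: vertices v ∉ X.  Partite set 2: one vertex x_{p,q} per
  -- unordered nonadjacent pair {p,q} ⊆ X, represented by the ordered pair
  -- (p , q) with p < q.
  HLeft : Subset n → Fin n → Set
  HLeft X v = v ∉ X

  HRight : Subset n → Fin n × Fin n → Set
  HRight X (p , q) = p < q × p ∈ X × q ∈ X × ¬ E G p q

  HAdj : Subset n → Fin n × Fin n → Fin n → Set
  HAdj X (p , q) v = HRight X (p , q) × HLeft X v × E G v p × E G v q

  HNbr : Subset n → Subset n → Fin n × Fin n → Set
  HNbr X T x = ∃[ t ] (t ∈ T × HAdj X x t)

  ElimV : Subset n → Fin n → Set
  ElimV T u = u ∉ T

  ElimE : Subset n → Fin n → Fin n → Set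
  ElimE T u w = u ∉ T × w ∉ T × u ≢ w ×
                (E G u w ⊎ ∃[ t ] (t ∈ T × E G t u × E G t w))

  DelV : Fin n → Fin n → Set
  DelV v u = u ≢ v

  DelE : Fin n → Fin n → Fin n → Set
  DelE v u w = u ≢ v × w ≢ v × E G u w

SaturatedByStars : {A B : Set} → (q : ℕ) → (Adj : A → B → Set) →
                   (S : A → Set) → (T : B → Set) → Set
SaturatedByStars {A} {B} q Adj S T =
  Σ (A → Vec B q) λ f →
    (∀ s → S s →
       (∀ i j → i ≢ j → lookup (f s) i ≢ lookup (f s) j) ×
       (∀ i → T (lookup (f s) i) × Adj s (lookup (f s) i))) ×
    (∀ s s' → S s → S s' → s ≢ s' → ∀ i j → lookup (f s) i ≢ lookup (f s') j)

data PathIn {n : ℕ} (E : Fin n → Fin n → Set) (B : Subset n) : Fin n → Fin n → Set where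
  here : ∀ {x} → x ∈ B → PathIn E B x x
  step : ∀ {x y z} → x ∈ B → E x y → PathIn E B y z → PathIn E B x z

IsMinor : {n : ℕ} → (VH : Fin n → Set) (EH : Fin n → Fin n → Set)
                  → (VG : Fin n → Set) (EG : Fin n → Fin n → Set) → Set
IsMinor {n} VH EH VG EG =
  Σ (Fin n → Subset n) λ B →
    (∀ u x → VH u → x ∈ B u → VG x) ×
    (∀ u → VH u → ∃[ x ] (x ∈ B u)) ×
    (∀ u w x → VH u → VH w → x ∈ B u → x ∈ B w → u ≡ w) ×
    (∀ u x y → VH u → x ∈ B u → y ∈ B u → PathIn EG (B u) x y) ×
    (∀ u w → VH u → VH w → EH u w → ∃[ x ] ∃[ y ] (x ∈ B u × y ∈ B w × EG x y))

TreewidthInvariant : {n : ℕ} → Graph n → Subset n → Set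
TreewidthInvariant G T =
  Independent G T ×
  (∀ v → v ∈ T → IsMinor (ElimV G T) (ElimE G T) (DelV G v) (DelE G v))

-- Since X is a vertex cover and T avoids X, T is independent and every neighbour of a vertex of T
-- lies in X.  Fix v ∈ T.  A fill-in edge uw of Ĝ_T (u < w nonadjacent, with a common neighbour
-- in T) is a non-edge x_{u,w} of H_{G,X} lying in S = N_H(T), so it owns a 2-star of leaves in T,
-- each adjacent to both u and w.  At least one leaf differs from v; put all such leaves into the
-- branch set of u.  Branch sets are stars centred at u, hence connected in G - v; they are disjoint
-- because the 2-stars are; and the chosen leaf realises the edge uw.

module Submission where

open import Defs
open import Data.Nat using (ℕ; suc)
open import Data.Integer using (ℤ)
open import Data.Fin using (Fin; _<_; zero; suc)
open import Data.Fin.Subset using (Subset; _∈_; _∉_)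
open import Data.Fin.Properties using (_≟_; _<?_; <-cmp; any?)
open import Data.Fin.Subset.Properties using (_∈?_)
open import Data.Vec using (Vec; lookup; tabulate)
open import Data.Vec.Properties using (lookup∘tabulate; []=⇒lookup; lookup⇒[]=)
open import Data.Bool.Properties using (T-≡)
open import Data.Product using (∃-syntax; _×_; _,_; proj₁; proj₂)
open import Data.Sum using (_⊎_; inj₁; inj₂)
open import Data.Empty using (⊥-elim)
open import Function using (_∘_; Equivalence)
open import Level using (Level)
open import Relation.Nullary using (¬_; Dec; yes; no; ¬?)
open import Relation.Nullary.Decidable using (_×-dec_; _⊎-dec_; isYes; fromWitness; toWitness)
open import Relation.Unary using (Pred; Decidable)
open import Relation.Binary using (DecidableEquality; tri<; tri≈; tri>)
open import Relation.Binary.PropositionalEquality using (_≡_; _≢_; refl; trans; cong) renaming (sym to ≡-sym)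

module _ {n : ℕ} {ℓ : Level} {P : Pred (Fin n) ℓ} (P? : Decidable P) where

  subset : Subset n
  subset = tabulate (isYes ∘ P?)

  ∈-subset⁺ : ∀ {x} → P x → x ∈ subset
  ∈-subset⁺ {x} px =
    lookup⇒[]= x subset (trans (lookup∘tabulate _ x) (Equivalence.to T-≡ (fromWitness px)))

  ∈-subset⁻ : ∀ {x} → x ∈ subset → P x
  ∈-subset⁻ {x} x∈ =
    toWitness (Equivalence.from T-≡ (trans (≡-sym (lookup∘tabulate _ x)) ([]=⇒lookup x∈)))

module _ {n : ℕ} {E : Fin n → Fin n → Set} {B : Subset n} where

  _++ₚ_ : ∀ {x y z} → PathIn E B x y → PathIn E B y z → PathIn E B x z
  here _      ++ₚ q = q
  step x∈ e p ++ₚ q = step x∈ e (p ++ₚ q)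

  star-connected : ∀ {c} → c ∈ B → (∀ {x} → x ∈ B → x ≡ c ⊎ (E x c × E c x)) →
                   ∀ {x y} → x ∈ B → y ∈ B → PathIn E B x y
  star-connected {c} c∈ spoke x∈ y∈ = to-centre x∈ ++ₚ from-centre y∈
    where
    to-centre : ∀ {z} → z ∈ B → PathIn E B z c
    to-centre z∈ with spoke z∈
    ... | inj₁ refl    = here z∈
    ... | inj₂ (e , _) = step z∈ e (here c∈)

    from-centre : ∀ {z} → z ∈ B → PathIn E B c z
    from-centre z∈ with spoke z∈
    ... | inj₁ refl    = here z∈
    ... | inj₂ (_ , e) = step c∈ e (here z∈)

pairwise-distinct-avoids : ∀ {A : Set} {k} → DecidableEquality A → (xs : Vec A (suc (suc k))) →
                           (∀ i j → i ≢ j → lookup xs i ≢ lookup xs j) →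
                           ∀ a → ∃[ i ] (lookup xs i ≢ a)
pairwise-distinct-avoids _≟ᴬ_ xs distinct a with lookup xs zero ≟ᴬ a
... | no  x₀≢a = zero , x₀≢a
... | yes x₀≡a = suc zero , λ x₁≡a → distinct zero (suc zero) (λ ()) (trans x₀≡a (≡-sym x₁≡a))

module _ {n : ℕ} (G : Graph n) where

  DelE-sym : ∀ {v u w} → DelE G v u w → DelE G v w u
  DelE-sym (u≢v , w≢v , e) = w≢v , u≢v , sym G e

  cover-complement-independent : ∀ {X T} → VertexCover G X → (∀ t → t ∈ T → t ∉ X) →
                                 Independent G T
  cover-complement-independent cover T∩X=∅ u w u∈T w∈T e with cover u w e
  ... | inj₁ u∈X = T∩X=∅ u u∈T u∈X
  ... | inj₂ w∈X = T∩X=∅ w w∈T w∈X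

  cover-neighbour : ∀ {X u w} → VertexCover G X → u ∉ X → E G u w → w ∈ X
  cover-neighbour {u = u} {w} cover u∉X e with cover u w e
  ... | inj₁ u∈X = ⊥-elim (u∉X u∈X)
  ... | inj₂ w∈X = w∈X

  HAdj? : ∀ X s x → Dec (HAdj G X s x)
  HAdj? X (p , q) x = ((p <? q) ×-dec (p ∈? X) ×-dec (q ∈? X) ×-dec ¬? (E? G p q))
                      ×-dec ¬? (x ∈? X) ×-dec E? G x p ×-dec E? G x q

module EliminationMinor {n : ℕ} (G : Graph n) (X T : Subset n)
  (cover : VertexCover G X) (T∩X=∅ : ∀ t → t ∈ T → t ∉ X)
  (stars : SaturatedByStars 2 (HAdj G X) (HNbr G X T) (_∈ T))
  where

  star : Fin n × Fin n → Vec (Fin n) 2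
  star = proj₁ stars

  star-distinct : ∀ s → HNbr G X T s → ∀ i j → i ≢ j → lookup (star s) i ≢ lookup (star s) j
  star-distinct s s∈S = proj₁ (proj₁ (proj₂ stars) s s∈S)

  star-leaf : ∀ s → HNbr G X T s → ∀ i → lookup (star s) i ∈ T × HAdj G X s (lookup (star s) i)
  star-leaf s s∈S = proj₂ (proj₁ (proj₂ stars) s s∈S)

  stars-disjoint : ∀ s s′ → HNbr G X T s → HNbr G X T s′ → s ≢ s′ →
                   ∀ i j → lookup (star s) i ≢ lookup (star s′) j
  stars-disjoint = proj₂ (proj₂ stars)

  fill-in-pair-in-S : ∀ {u w t} → t ∈ T → E G t u → E G t w → u < w → ¬ E G u w →
                      HNbr G X T (u , w)
  fill-in-pair-in-S {t = t} t∈T tu tw u<w ¬uw =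
    t , t∈T , (u<w , in-X tu , in-X tw , ¬uw) , T∩X=∅ t t∈T , tu , tw
    where
    in-X : ∀ {x} → E G t x → x ∈ X
    in-X = cover-neighbour G cover (T∩X=∅ t t∈T)

  module _ (v : Fin n) (v∈T : v ∈ T) where

    -- HAdj forces u < q, so each 2-star feeds only the branch set of its smaller endpoint.
    Leaf : Fin n → Fin n → Set
    Leaf u x = x ∈ T × x ≢ v × ∃[ q ] (HAdj G X (u , q) x × ∃[ i ] (lookup (star (u , q)) i ≡ x))

    Leaf? : ∀ u x → Dec (Leaf u x)
    Leaf? u x = (x ∈? T) ×-dec ¬? (x ≟ v) ×-dec
                any? (λ q → HAdj? G X (u , q) x ×-dec any? (λ i → lookup (star (u , q)) i ≟ x))

    InBranch : Fin n → Fin n → Set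
    InBranch u x = x ≡ u ⊎ Leaf u x

    branch : Fin n → Subset n
    branch u = subset (λ x → (x ≟ u) ⊎-dec Leaf? u x)

    centre∈branch : ∀ u → u ∈ branch u
    centre∈branch u = ∈-subset⁺ _ (inj₁ refl)

    leaf∈branch : ∀ {u x} → Leaf u x → x ∈ branch u
    leaf∈branch = ∈-subset⁺ _ ∘ inj₂

    branch-members : ∀ {u x} → x ∈ branch u → InBranch u x
    branch-members = ∈-subset⁻ _

    ∉T⇒≢v : ∀ {u} → u ∉ T → u ≢ v
    ∉T⇒≢v u∉T refl = u∉T v∈T

    branch-avoids-v : ∀ u x → u ∉ T → x ∈ branch u → x ≢ v
    branch-avoids-v u x u∉T x∈ with branch-members x∈
    ... | inj₁ refl          = ∉T⇒≢v u∉T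
    ... | inj₂ (_ , x≢v , _) = x≢v

    branches-disjoint : ∀ u w x → u ∉ T → w ∉ T → x ∈ branch u → x ∈ branch w → u ≡ w
    branches-disjoint u w x u∉T w∉T x∈u x∈w with branch-members x∈u | branch-members x∈w
    ... | inj₁ refl      | inj₁ refl      = refl
    ... | inj₁ refl      | inj₂ (x∈T , _) = ⊥-elim (u∉T x∈T)
    ... | inj₂ (x∈T , _) | inj₁ refl      = ⊥-elim (w∉T x∈T)
    ... | inj₂ (x∈T , _ , q , a , i , eq) | inj₂ (_ , _ , q′ , a′ , j , eq′) with u ≟ w
    ...   | yes u≡w = u≡w
    ...   | no  u≢w = ⊥-elim (stars-disjoint (u , q) (w , q′) (x , x∈T , a) (x , x∈T , a′)
                                              (u≢w ∘ cong proj₁) i j (trans eq (≡-sym eq′)))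

    branch-connected : ∀ u x y → u ∉ T → x ∈ branch u → y ∈ branch u →
                       PathIn (DelE G v) (branch u) x y
    branch-connected u _ _ u∉T = star-connected (centre∈branch u) spoke
      where
      spoke : ∀ {x} → x ∈ branch u → x ≡ u ⊎ (DelE G v x u × DelE G v u x)
      spoke x∈ with branch-members x∈
      ... | inj₁ x≡u = inj₁ x≡u
      ... | inj₂ (_ , x≢v , _ , (_ , _ , xu , _) , _) =
            let e = x≢v , ∉T⇒≢v u∉T , xu in inj₂ (e , DelE-sym G e)

    fill-in-realised : ∀ {u w t} → w ∉ T → t ∈ T → E G t u → E G t w → u < w → ¬ E G u w →
                       ∃[ y ] (y ∈ branch u × DelE G v y w)
    fill-in-realised {u} {w} w∉T t∈T tu tw u<w ¬uw =
      let i , y≢v = pairwise-distinct-avoids _≟_ (star (u , w)) (star-distinct _ s∈S) v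
          y∈T , adj@(_ , _ , _ , yw) = star-leaf _ s∈S i
      in lookup (star (u , w)) i , leaf∈branch (y∈T , y≢v , w , adj , i , refl)
       , y≢v , ∉T⇒≢v w∉T , yw
      where
      s∈S : HNbr G X T (u , w)
      s∈S = fill-in-pair-in-S t∈T tu tw u<w ¬uw

    edge-realised : ∀ u w → u ∉ T → w ∉ T → ElimE G T u w →
                    ∃[ x ] ∃[ y ] (x ∈ branch u × y ∈ branch w × DelE G v x y)
    edge-realised u w u∉T w∉T (_ , _ , u≢w , filled) with E? G u w
    ... | yes uw = u , w , centre∈branch u , centre∈branch w , ∉T⇒≢v u∉T , ∉T⇒≢v w∉T , uw
    ... | no ¬uw with filled | <-cmp u w
    ...   | inj₁ uw                  | _            = ⊥-elim (¬uw uw)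
    ...   | inj₂ _                   | tri≈ _ u≡w _ = ⊥-elim (u≢w u≡w)
    ...   | inj₂ (t , t∈T , tu , tw) | tri< u<w _ _ =
            let y , y∈ , yw = fill-in-realised w∉T t∈T tu tw u<w ¬uw
            in y , w , y∈ , centre∈branch w , yw
    ...   | inj₂ (t , t∈T , tu , tw) | tri> _ _ w<u =
            let y , y∈ , yu = fill-in-realised u∉T t∈T tw tu w<u (¬uw ∘ sym G)
            in u , y , centre∈branch u , y∈ , DelE-sym G yu

    elimination-minor : IsMinor (ElimV G T) (ElimE G T) (DelV G v) (DelE G v)
    elimination-minor = branch , branch-avoids-v , (λ u _ → u , centre∈branch u)
                      , branches-disjoint , branch-connected , edge-realised

lemma9 : {n : ℕ} (G : Graph n) (X : Subset n) (k : ℤ) →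
    VertexCover G X →
    (T : Subset n) → (∀ v → v ∈ T → v ∉ X) →
    SaturatedByStars 2 (HAdj G X) (HNbr G X T) (λ v → v ∈ T) →
    TreewidthInvariant G T
lemma9 G X _ cover T T∩X=∅ stars =
  cover-complement-independent G cover T∩X=∅ , EliminationMinor.elimination-minor G X T cover T∩X=∅ stars
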